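{- Let $M$ be a finite set of graphs with $M\cap\mathcal{S}=\emptyset$. Then there exists $r\in\mathbb{N}$ (with $r\ge 3$) such that $\mathcal{S}_r$ is contained in the class of graphs containing no graph of $M$ as an si-subgraph.
   Context: All graphs are finite and simple. For graphs $G_1=(V_1,E_1)$, $G_2=(V_2,E_2)$, $G_1\cap G_2=(V_1\cap V_2,E_1\cap E_2)$. For $G=(V,E)$ and an injective map $\alpha$ on $V$, $G^{\alpha}$ has vertex set $\alpha(V)$ and edge set $\{\{\alpha(v),\alpha(w)\}:\{v,w\}\in E\}$. $H$ is an si-subgraph of $G$ if $H=G^{\alpha_1}\cap\cdots\cap G^{\alpha_k}$ for some injective maps $\alpha_1,\dots,\alpha_k$ on $V(G)$ (up to isomorphism of $H$). $\mathcal{S}$ is the class of forests in which every connected component is a tree with at most three leaves. For $k\ge 1$, $H_k$ is the graph obtained from two disjoint copies of the path $P_3$ by joining their middle vertices by a path with $k$ edges; $H_0=K_{1,4}$. For $k\ge 3$, $\mathcal{S}_k$ is the class of graphs containing none of $C_3,\dots,C_k,H_0,H_1,\dots,H_k$ as a (not necessarily induced) subgraph. -}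

module Defs where

open import Data.Nat using (ℕ; zero; suc; _+_; _≤_; _≡ᵇ_)
open import Data.Fin using (Fin; toℕ)
open import Data.Bool using (Bool; true; false; _∧_; _∨_; not; if_then_else_)
open import Data.List using (List; []; _∷_; _++_; map; upTo; allFin)
open import Data.Bool.ListAction using (any)
open import Data.Nat.ListAction using (sum)
open import Data.List.Membership.Propositional using (_∈_)
open import Data.Product using (Σ; ∃; _×_; _,_)
open import Data.Empty using (⊥)
open import Relation.Binary.PropositionalEquality using (_≡_)
open import Function.Definitions using (Injective)
open import Function.Bundles using (_⇔_)

record Graph : Set where
  field
    size   : ℕ
    adj    : Fin size → Fin size → Bool
    sym    : ∀ i j → adj i j ≡ adj j i
    irrefl : ∀ i → adj i i ≡ false
open Graph public

V : Graph → Set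
V G = Fin (size G)

Edge : (G : Graph) → V G → V G → Set
Edge G u v = adj G u v ≡ true

adjL : List (ℕ × ℕ) → ℕ → ℕ → Bool
adjL es i j = not (i ≡ᵇ j) ∧ any (λ { (a , b) → ((a ≡ᵇ i) ∧ (b ≡ᵇ j)) ∨ ((a ≡ᵇ j) ∧ (b ≡ᵇ i)) }) es

private
  ≡ᵇ-sym : ∀ i j → (i ≡ᵇ j) ≡ (j ≡ᵇ i)
  ≡ᵇ-sym zero zero = Relation.Binary.PropositionalEquality.refl
  ≡ᵇ-sym zero (suc j) = Relation.Binary.PropositionalEquality.refl
  ≡ᵇ-sym (suc i) zero = Relation.Binary.PropositionalEquality.refl
  ≡ᵇ-sym (suc i) (suc j) = ≡ᵇ-sym i j

  ≡ᵇ-refl : ∀ i → (i ≡ᵇ i) ≡ true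
  ≡ᵇ-refl zero = Relation.Binary.PropositionalEquality.refl
  ≡ᵇ-refl (suc i) = ≡ᵇ-refl i

  ∨-comm : ∀ x y → (x ∨ y) ≡ (y ∨ x)
  ∨-comm false false = Relation.Binary.PropositionalEquality.refl
  ∨-comm false true = Relation.Binary.PropositionalEquality.refl
  ∨-comm true false = Relation.Binary.PropositionalEquality.refl
  ∨-comm true true = Relation.Binary.PropositionalEquality.refl

  anySym : ∀ (es : List (ℕ × ℕ)) i j →
    any (λ { (a , b) → ((a ≡ᵇ i) ∧ (b ≡ᵇ j)) ∨ ((a ≡ᵇ j) ∧ (b ≡ᵇ i)) }) es
    ≡ any (λ { (a , b) → ((a ≡ᵇ j) ∧ (b ≡ᵇ i)) ∨ ((a ≡ᵇ i) ∧ (b ≡ᵇ j)) }) es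
  anySym [] i j = Relation.Binary.PropositionalEquality.refl
  anySym ((a , b) ∷ es) i j =
    Relation.Binary.PropositionalEquality.cong₂ _∨_
      (∨-comm ((a ≡ᵇ i) ∧ (b ≡ᵇ j)) ((a ≡ᵇ j) ∧ (b ≡ᵇ i))) (anySym es i j)

  adjL-irrefl : ∀ es i → adjL es i i ≡ false
  adjL-irrefl es i rewrite ≡ᵇ-refl i = Relation.Binary.PropositionalEquality.refl

fromEdges : (n : ℕ) → List (ℕ × ℕ) → Graph
fromEdges n es = record
  { size = n
  ; adj = λ i j → adjL es (toℕ i) (toℕ j)
  ; sym = λ i j → Relation.Binary.PropositionalEquality.cong₂ _∧_
            (Relation.Binary.PropositionalEquality.cong not (≡ᵇ-sym (toℕ i) (toℕ j)))
            (anySym es (toℕ i) (toℕ j))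
  ; irrefl = λ i → adjL-irrefl es (toℕ i)
  }

-- Cycle C_k on vertices 0..k-1 (meaningful for k ≥ 3).
cycleEdges : ℕ → List (ℕ × ℕ)
cycleEdges zero = []
cycleEdges (suc k) = (k , 0) ∷ map (λ j → (j , suc j)) (upTo k)

C : ℕ → Graph
C k = fromEdges k (cycleEdges k)

-- H_k (k ≥ 1): P_3 with middle 0 and leaves 1,2; P_3 with middle 3 and
-- leaves 4,5; path 0 = p_0, p_1, ..., p_k = 3 with internal vertices
-- p_j = 5 + j (1 ≤ j ≤ k-1).  k + 5 vertices in total.
pv : ℕ → ℕ → ℕ
pv k zero = 0
pv k (suc j) = if suc j ≡ᵇ k then 3 else 5 + suc j

H : ℕ → Graph
H zero = fromEdges 5 ((0 , 1) ∷ (0 , 2) ∷ (0 , 3) ∷ (0 , 4) ∷ [])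
H (suc k) = fromEdges (suc k + 5)
  ((0 , 1) ∷ (0 , 2) ∷ (3 , 4) ∷ (3 , 5) ∷ map (λ j → (pv (suc k) j , pv (suc k) (suc j))) (upTo (suc k)))

Contains : Graph → Graph → Set
Contains G F = Σ (V F → V G) λ f → Injective _≡_ _≡_ f × (∀ a b → Edge F a b → Edge G (f a) (f b))

-- The class 𝒮: forests each of whose components has at most three leaves.

deg : (G : Graph) → V G → ℕ
deg G v = sum (map (λ w → if adj G v w then 1 else 0) (allFin (size G)))

Leaf : (G : Graph) → V G → Set
Leaf G v = deg G v ≡ 1

data Reach (G : Graph) : V G → V G → Set where
  here : ∀ {v} → Reach G v v
  step : ∀ {u w v} → Edge G u w → Reach G w v → Reach G u v

Forest : Graph → Set
Forest G = ∀ k → 3 ≤ k → Contains G (C k) → ⊥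

ComponentsAtMost3Leaves : Graph → Set
ComponentsAtMost3Leaves G =
  (f : Fin 4 → V G) → Injective _≡_ _≡_ f → (∀ i → Leaf G (f i)) →
  (∀ i → Reach G (f Data.Fin.zero) (f i)) → ⊥

InS : Graph → Set
InS G = Forest G × ComponentsAtMost3Leaves G

InSk : ℕ → Graph → Set
InSk k G = (∀ j → 3 ≤ j → j ≤ k → Contains G (C j) → ⊥)
         × (∀ j → j ≤ k → Contains G (H j) → ⊥)

-- G^{α_1} ∩ ... ∩ G^{α_k} for k ≥ 1 injective maps
-- α_i : V(G) → ℕ (ℕ serves as the ambient universe of vertex names);
-- F is an si-subgraph of G if F is isomorphic to such an intersection,
-- witnessed by an injective φ : V(F) → ℕ onto the intersection's vertex
-- set, under which the edges of F are exactly the intersection's edges.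

InterVertex : (G : Graph) (k : ℕ) (α : Fin (suc k) → V G → ℕ) → ℕ → Set
InterVertex G k α u = ∀ i → ∃ λ v → α i v ≡ u

InterEdge : (G : Graph) (k : ℕ) (α : Fin (suc k) → V G → ℕ) → ℕ → ℕ → Set
InterEdge G k α x y = ∀ i → ∃ λ v → ∃ λ w → α i v ≡ x × α i w ≡ y × Edge G v w

SiSub : Graph → Graph → Set
SiSub F G =
  Σ ℕ λ k → Σ (Fin (suc k) → V G → ℕ) λ α → (∀ i → Injective _≡_ _≡_ (α i)) ×
  Σ (V F → ℕ) λ φ → Injective _≡_ _≡_ φ
    × (∀ a → InterVertex G k α (φ a))
    × (∀ u → InterVertex G k α u → ∃ λ a → φ a ≡ u)
    × (∀ a b → Edge F a b ⇔ InterEdge G k α (φ a) (φ b))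

-- If an si-subgraph F of G is witnessed by α₁, …, αₖ, then α₁ alone embeds F into G, so every C_j or
-- H_j in F is one in G, on at most |F| vertices. Taking r = 3 + Σ_{F ∈ M} |F|, a graph of 𝒮_r therefore
-- forces each F ∈ M to contain no cycle and no H_j at all, and such an F lies in 𝒮: if four leaves
-- ℓ₀, …, ℓ₃ shared a component, join ℓ₀ to ℓ₁ by a path P, ℓ₂ to P by a path Q and ℓ₃ to P ∪ Q by a
-- path R, each meeting its target only at its last vertex. Both attachment vertices are internal (the
-- ends of P and Q are leaves), each has a neighbour off P ∪ Q, and the path between them with two further
-- neighbours at either end is an H_j (K_{1,4} when the attachment vertices coincide).
module Submission where

open import Defs hiding (sym)
open import Data.Nat using (ℕ; zero; suc; _+_; _∸_; _≤_; _<_; z≤n; s≤s; z<s; _≡ᵇ_)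
open import Data.Nat.Properties
open import Data.Nat.ListAction using (sum)
open import Data.Bool using (true; false; T; _∧_; _∨_; if_then_else_)
open import Data.Bool.Properties using (T-≡; T-∧; T-∨)
open import Data.Fin using (Fin; toℕ; #_) renaming (zero to 0F; suc to sucF)
open import Data.Fin.Properties using (toℕ-injective; toℕ<n; injective⇒≤)
import Data.Fin.Properties as Finₚ
open import Data.List using (List; []; _∷_; map; lookup; upTo)
open import Data.List.Membership.Propositional using (_∈_)
open import Data.List.Membership.Propositional.Properties using (∈-allFin; ∈-lookup; ∈-map⁻; ∈-upTo⁻)
open import Data.List.Relation.Unary.All as All using (All; []; _∷_)
open import Data.List.Relation.Unary.AllPairs using ([]; _∷_)
open import Data.List.Relation.Unary.Any as Any using (here; there)
open import Data.List.Relation.Unary.Any.Properties using (any⁻; Any-⊎⁻)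
open import Data.List.Relation.Unary.Unique.Propositional using (Unique)
open import Data.Product using (Σ; ∃; _×_; _,_; proj₁; proj₂)
open import Data.Sum using (_⊎_; inj₁; inj₂; [_,_]′)
open import Data.Unit using (⊤; tt)
open import Data.Empty using (⊥; ⊥-elim)
open import Function using (_∘_)
open import Function.Bundles using (Equivalence)
open import Function.Definitions using (Injective)
open import Relation.Binary.PropositionalEquality
open import Relation.Nullary using (¬_; yes; no)
open import Relation.Nullary.Decidable using (map′; _⊎-dec_)
open import Relation.Unary using (Decidable)

private
  variable
    G F X : Graph
    k n m L : ℕ

module _ {A : Set} (f : A → ℕ) where

  ∈⇒≤sum : ∀ {xs u} → u ∈ xs → f u ≤ sum (map f xs)
  ∈⇒≤sum {x ∷ xs} (here refl) = m≤m+n (f x) _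
  ∈⇒≤sum {x ∷ xs} (there u∈xs) = ≤-trans (∈⇒≤sum u∈xs) (m≤n+m _ (f x))

  distinct-∈⇒+≤sum : ∀ {xs u w} → u ∈ xs → w ∈ xs → u ≢ w → f u + f w ≤ sum (map f xs)
  distinct-∈⇒+≤sum (here refl) (here refl) u≢w = ⊥-elim (u≢w refl)
  distinct-∈⇒+≤sum {x ∷ xs} (here refl) (there w∈xs) _ = +-monoʳ-≤ (f x) (∈⇒≤sum w∈xs)
  distinct-∈⇒+≤sum {x ∷ xs} {u} (there u∈xs) (here refl) _ =
    subst (_≤ f x + sum (map f xs)) (+-comm (f x) (f u)) (+-monoʳ-≤ (f x) (∈⇒≤sum u∈xs))
  distinct-∈⇒+≤sum {x ∷ xs} (there u∈xs) (there w∈xs) u≢w =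
    ≤-trans (distinct-∈⇒+≤sum u∈xs w∈xs u≢w) (m≤n+m _ (f x))

lookup-injective : ∀ {A : Set} {xs : List A} → Unique xs → ∀ {i j} → lookup xs i ≡ lookup xs j → i ≡ j
lookup-injective (_ ∷ _) {0F} {0F} _ = refl
lookup-injective (x≢xs ∷ _) {0F} {sucF j} eq = ⊥-elim (All.lookup x≢xs (∈-lookup j) eq)
lookup-injective (x≢xs ∷ _) {sucF i} {0F} eq = ⊥-elim (All.lookup x≢xs (∈-lookup i) (sym eq))
lookup-injective (_ ∷ xs-unique) {sucF i} {sucF j} eq = cong sucF (lookup-injective xs-unique eq)

module _ (G : Graph) where

  edge-sym : ∀ {u v} → Edge G u v → Edge G v u
  edge-sym {u} {v} e = trans (Graph.sym G v u) e

  leaf-neighbour-unique : ∀ {v u w} → Leaf G v → Edge G v u → Edge G v w → u ≡ w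
  leaf-neighbour-unique {v} {u} {w} leaf e₁ e₂ with u Finₚ.≟ w
  ... | yes u≡w = u≡w
  ... | no u≢w = ⊥-elim (1+n≰n (subst (2 ≤_) leaf two≤deg))
    where
      indicator : V G → ℕ
      indicator x = if adj G v x then 1 else 0

      two≤deg : 2 ≤ deg G v
      two≤deg = subst₂ (λ a b → a + b ≤ deg G v)
        (cong (λ b → if b then 1 else 0) e₁) (cong (λ b → if b then 1 else 0) e₂)
        (distinct-∈⇒+≤sum indicator (∈-allFin u) (∈-allFin w) u≢w)

Reach-snoc : ∀ {u v w} → Reach G u v → Edge G v w → Reach G u w
Reach-snoc here e = step e here
Reach-snoc (step e r) e′ = step e (Reach-snoc r e′)

Reach-sym : ∀ {u v} → Reach G u v → Reach G v u
Reach-sym here = here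
Reach-sym {G} (step e r) = Reach-snoc (Reach-sym r) (edge-sym G e)

Contains-trans : Contains G F → Contains F X → Contains G X
Contains-trans (f , f-inj , f-edge) (g , g-inj , g-edge) =
  f ∘ g , g-inj ∘ f-inj , λ a b → f-edge _ _ ∘ g-edge a b

Contains⇒size≤ : Contains G F → size F ≤ size G
Contains⇒size≤ (_ , f-inj , _) = injective⇒≤ f-inj

SiSub⇒Contains : SiSub F G → Contains G F
SiSub⇒Contains {F} {G} (_ , α , α-inj , φ , φ-inj , φ-vertex , _ , φ-edge) = f , f-inj , f-edge
  where
    f : V F → V G
    f a = proj₁ (φ-vertex a 0F)

    α₀∘f : ∀ a → α 0F (f a) ≡ φ a
    α₀∘f a = proj₂ (φ-vertex a 0F)

    f-inj : Injective _≡_ _≡_ f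
    f-inj {a} {b} fa≡fb = φ-inj (trans (sym (α₀∘f a)) (trans (cong (α 0F) fa≡fb) (α₀∘f b)))

    f-edge : ∀ a b → Edge F a b → Edge G (f a) (f b)
    f-edge a b e with Equivalence.to (φ-edge a b) e 0F
    ... | v , w , αv , αw , vw =
      subst₂ (Edge G) (α-inj 0F (trans αv (sym (α₀∘f a)))) (α-inj 0F (trans αw (sym (α₀∘f b)))) vw

adjL-true⇒listed : ∀ es i j → adjL es i j ≡ true → (i , j) ∈ es ⊎ (j , i) ∈ es
adjL-true⇒listed es i j h =
  Any-⊎⁻ (Any.map (λ { {a , b} → endpoints a b })
                   (any⁻ _ es (proj₂ (Equivalence.to T-∧ (Equivalence.from T-≡ h)))))
  where
    endpoints : ∀ a b → T (((a ≡ᵇ i) ∧ (b ≡ᵇ j)) ∨ ((a ≡ᵇ j) ∧ (b ≡ᵇ i))) →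
                (i , j) ≡ (a , b) ⊎ (j , i) ≡ (a , b)
    endpoints a b t with Equivalence.to T-∨ t
    ... | inj₁ t₁ = let (a≡i , b≡j) = Equivalence.to T-∧ t₁ in
      inj₁ (sym (cong₂ _,_ (≡ᵇ⇒≡ a i a≡i) (≡ᵇ⇒≡ b j b≡j)))
    ... | inj₂ t₂ = let (a≡j , b≡i) = Equivalence.to T-∧ t₂ in
      inj₂ (sym (cong₂ _,_ (≡ᵇ⇒≡ a j a≡j) (≡ᵇ⇒≡ b i b≡i)))

fromEdges-embedding : ∀ {es} (g : ℕ → V G) →
  (∀ {x y} → x < n → y < n → g x ≡ g y → x ≡ y) →
  (∀ {x y} → (x , y) ∈ es → Edge G (g x) (g y)) →
  Contains G (fromEdges n es)
fromEdges-embedding {G} {es = es} g g-inj g-edge =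
  g ∘ toℕ ,
  (λ {a} {b} eq → toℕ-injective (g-inj (toℕ<n a) (toℕ<n b) eq)) ,
  λ a b e → [ g-edge , edge-sym G ∘ g-edge ]′ (adjL-true⇒listed es (toℕ a) (toℕ b) e)

record Path (G : Graph) (n : ℕ) : Set where
  field
    vertex    : ℕ → V G
    adjacent  : ∀ {t} → t < n → Edge G (vertex t) (vertex (suc t))
    injective : ∀ {t u} → t ≤ n → u ≤ n → vertex t ≡ vertex u → t ≡ u

  OnPath : V G → Set
  OnPath v = ∃ λ t → t ≤ n × vertex t ≡ v

  onPath? : Decidable OnPath
  onPath? v = map′ (λ (t , t<1+n , eq) → t , ≤-pred t<1+n , eq) (λ (t , t≤n , eq) → t , s≤s t≤n , eq)
    (anyUpTo? (λ t → vertex t Finₚ.≟ v) (suc n))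

  vertex-≢ : ∀ {t u} → t ≤ n → u ≤ n → t ≢ u → vertex t ≢ vertex u
  vertex-≢ t≤n u≤n t≢u = t≢u ∘ injective t≤n u≤n

  off-path-≢ : ∀ {t z} → ¬ OnPath z → t ≤ n → vertex t ≢ z
  off-path-≢ z∉P t≤n eq = z∉P (_ , t≤n , eq)

open Path

trivial-path : V G → Path G 0
trivial-path x = record { vertex = λ _ → x ; adjacent = λ () ; injective = λ { z≤n z≤n _ → refl } }

subpath : (P : Path G n) (s : ℕ) → L + s ≤ n → Path G L
subpath {n = n} {L = L} P s L+s≤n = record
  { vertex    = λ t → vertex P (t + s)
  ; adjacent  = λ t<L → adjacent P (≤-trans (+-monoˡ-< s t<L) L+s≤n)
  ; injective = λ t≤L u≤L eq → +-cancelʳ-≡ s _ _ (injective P (bound t≤L) (bound u≤L) eq)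
  }
  where
    bound : ∀ {t} → t ≤ L → t + s ≤ n
    bound t≤L = ≤-trans (+-monoˡ-≤ s t≤L) L+s≤n

subpath-⊆ : ∀ (P : Path G n) s (L+s≤n : L + s ≤ n) {v} → OnPath (subpath P s L+s≤n) v → OnPath P v
subpath-⊆ P s L+s≤n (t , t≤L , eq) = t + s , ≤-trans (+-monoˡ-≤ s t≤L) L+s≤n , eq

subpath-outside : ∀ (P : Path G n) s (L+s≤n : L + s ≤ n) {p} → p ≤ n → p < s ⊎ L + s < p →
  ¬ OnPath (subpath P s L+s≤n) (vertex P p)
subpath-outside {L = L} P s L+s≤n p≤n p-outside (t , t≤L , eq)
  with injective P p≤n (≤-trans (+-monoˡ-≤ s t≤L) L+s≤n) (sym eq) | p-outside
... | refl | inj₁ t+s<s = <⇒≱ t+s<s (m≤n+m s t)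
... | refl | inj₂ L+s<t+s = <⇒≱ L+s<t+s (+-monoˡ-≤ s t≤L)

prepend : ∀ x (P : Path G n) → Edge G x (vertex P 0) → ¬ OnPath P x → Path G (suc n)
prepend {G} {n} x P x~P₀ x∉P = record { vertex = vertex′ ; adjacent = adjacent′ ; injective = injective′ }
  where
    vertex′ : ℕ → V G
    vertex′ zero = x
    vertex′ (suc t) = vertex P t

    adjacent′ : ∀ {t} → t < suc n → Edge G (vertex′ t) (vertex′ (suc t))
    adjacent′ {zero} _ = x~P₀
    adjacent′ {suc t} (s≤s t<n) = adjacent P t<n

    injective′ : ∀ {t u} → t ≤ suc n → u ≤ suc n → vertex′ t ≡ vertex′ u → t ≡ u
    injective′ {zero} {zero} _ _ _ = refl
    injective′ {zero} {suc u} _ (s≤s u≤n) eq = ⊥-elim (x∉P (u , u≤n , sym eq))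
    injective′ {suc t} {zero} (s≤s t≤n) _ eq = ⊥-elim (x∉P (t , t≤n , eq))
    injective′ {suc t} {suc u} (s≤s t≤n) (s≤s u≤n) eq = cong suc (injective P t≤n u≤n eq)

record PathInto (G : Graph) (x : V G) (S : V G → Set) (n : ℕ) : Set where
  field
    path   : Path G n
    starts : Path.vertex path 0 ≡ x
    ends   : S (Path.vertex path n)
    avoids : ∀ {t} → t < n → ¬ S (Path.vertex path t)

open PathInto using (path; starts; ends; avoids)

module _ {x : V G} {S : V G → Set} where

  PathInto-zero : PathInto G x S 0 → S x
  PathInto-zero P = subst S (starts P) (ends P)

  PathInto-here : S x → PathInto G x S 0
  PathInto-here x∈S = record { path = trivial-path x ; starts = refl ; ends = x∈S ; avoids = λ () }

  PathInto-suffix : ∀ {y i} (P : PathInto G y S n) → i ≤ n → vertex (path P) i ≡ x → PathInto G x S (n ∸ i)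
  PathInto-suffix {n = n} {i = i} P i≤n Pᵢ≡x = record
    { path   = subpath (path P) i (≤-reflexive n∸i+i≡n)
    ; starts = Pᵢ≡x
    ; ends   = subst (S ∘ vertex (path P)) (sym n∸i+i≡n) (ends P)
    ; avoids = λ t<n∸i → avoids P (subst (_ <_) n∸i+i≡n (+-monoˡ-< i t<n∸i))
    }
    where
      n∸i+i≡n : n ∸ i + i ≡ n
      n∸i+i≡n = m∸n+n≡m i≤n

  PathInto-prepend : ∀ {y} → ¬ S x → Edge G x y → (P : PathInto G y S n) → ¬ OnPath (path P) x →
    PathInto G x S (suc n)
  PathInto-prepend x∉S x~y P x∉P = record
    { path   = prepend x (path P) (subst (Edge G x) (sym (starts P)) x~y) x∉P
    ; starts = refl
    ; ends   = ends P
    ; avoids = λ { {zero} _ → x∉S ; {suc t} (s≤s t<n) → avoids P t<n }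
    }

-- A walk becomes a path by cutting out the detour at each vertex it revisits.
reach⇒pathInto : ∀ {x y} {S : V G → Set} → Decidable S → Reach G x y → S y → ∃ (PathInto G x S)
reach⇒pathInto S? here y∈S = 0 , PathInto-here y∈S
reach⇒pathInto {x = x} S? (step x~w w↝y) y∈S with S? x
... | yes x∈S = 0 , PathInto-here x∈S
... | no x∉S with reach⇒pathInto S? w↝y y∈S
...   | n , P with onPath? (path P) x
...     | yes (i , i≤n , Pᵢ≡x) = n ∸ i , PathInto-suffix P i≤n Pᵢ≡x
...     | no x∉P = suc n , PathInto-prepend x∉S x~w P x∉P

module _ {G : Graph} (P : Path G n) where

  leaf-neighbour-on-path : ∀ {t z} → 0 < n → t ≤ n → Leaf G (vertex P t) → Edge G (vertex P t) z → OnPath P z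
  leaf-neighbour-on-path {zero} 0<n _ leaf e = 1 , 0<n , sym (leaf-neighbour-unique G leaf e (adjacent P 0<n))
  leaf-neighbour-on-path {suc t} _ t<n leaf e =
    t , <⇒≤ t<n , sym (leaf-neighbour-unique G leaf e (edge-sym G (adjacent P t<n)))

  leaf-on-path-is-endpoint : ∀ {v} → OnPath P v → Leaf G v → v ≡ vertex P 0 ⊎ v ≡ vertex P n
  leaf-on-path-is-endpoint (zero , _ , refl) _ = inj₁ refl
  leaf-on-path-is-endpoint (suc t , t<n , refl) leaf with m≤n⇒m<n∨m≡n t<n
  ... | inj₂ refl = inj₂ refl
  ... | inj₁ 1+t<n = ⊥-elim (vertex-≢ P (<⇒≤ t<n) 1+t<n (<⇒≢ (m<n⇒m<1+n (n<1+n t)))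
                       (leaf-neighbour-unique G leaf (edge-sym G (adjacent P t<n)) (adjacent P 1+t<n)))

  off-path-neighbour⇒internal : ∀ {t z} → 0 < n → Leaf G (vertex P 0) → Leaf G (vertex P n) →
    t ≤ n → Edge G (vertex P t) z → ¬ OnPath P z → 0 < t × t < n
  off-path-neighbour⇒internal {t} 0<n leaf₀ leafₙ t≤n e z∉P with m≤n⇒m<n∨m≡n t≤n
  ... | inj₂ refl = ⊥-elim (z∉P (leaf-neighbour-on-path 0<n t≤n leafₙ e))
  off-path-neighbour⇒internal {zero} 0<n leaf₀ _ _ e z∉P | inj₁ _ =
    ⊥-elim (z∉P (leaf-neighbour-on-path 0<n z≤n leaf₀ e))
  off-path-neighbour⇒internal {suc t} _ _ _ _ _ _ | inj₁ t<n = z<s , t<n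

-- The spine runs from the branch vertex carrying x₁, x₂ to the one carrying y₁, y₂; for k = 0 it is the
-- centre of K_{1,4}.
record HSubgraph (G : Graph) (k : ℕ) : Set where
  field
    spine : Path G k
    x₁ x₂ y₁ y₂ : V G
    x₁-adjacent : Edge G (vertex spine 0) x₁
    x₂-adjacent : Edge G (vertex spine 0) x₂
    y₁-adjacent : Edge G (vertex spine k) y₁
    y₂-adjacent : Edge G (vertex spine k) y₂

  legs : List (V G)
  legs = x₁ ∷ x₂ ∷ y₁ ∷ y₂ ∷ []

  field
    legs-off-spine : All (¬_ ∘ OnPath spine) legs
    legs-distinct  : Unique legs

module _ {G : Graph} (h : HSubgraph G k) where
  open HSubgraph h

  place : ℕ ⊎ Fin 4 → V G
  place = [ vertex spine , lookup legs ]′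

  InRange : ℕ ⊎ Fin 4 → Set
  InRange (inj₁ t) = t ≤ k
  InRange (inj₂ _) = ⊤

  place-injective : ∀ {a b} → InRange a → InRange b → place a ≡ place b → a ≡ b
  place-injective {inj₁ t} {inj₁ u} t≤k u≤k eq = cong inj₁ (injective spine t≤k u≤k eq)
  place-injective {inj₁ t} {inj₂ i} t≤k _ eq = ⊥-elim (All.lookup legs-off-spine (∈-lookup i) (t , t≤k , eq))
  place-injective {inj₂ i} {inj₁ t} _ t≤k eq =
    ⊥-elim (All.lookup legs-off-spine (∈-lookup i) (t , t≤k , sym eq))
  place-injective {inj₂ i} {inj₂ j} _ _ eq = cong inj₂ (lookup-injective legs-distinct eq)

  labelled-embedding : ∀ {es} (role : ℕ → ℕ ⊎ Fin 4) (label : ℕ ⊎ Fin 4 → ℕ) →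
    (∀ {x} → x < n → InRange (role x) × label (role x) ≡ x) →
    (∀ {x y} → (x , y) ∈ es → Edge G (place (role x)) (place (role y))) →
    Contains G (fromEdges n es)
  labelled-embedding {n} role label recover edges =
    fromEdges-embedding {G} (place ∘ role) role-injective edges
    where
      role-injective : ∀ {x y} → x < n → y < n → place (role x) ≡ place (role y) → x ≡ y
      role-injective x<n y<n eq =
        let (x-in , x-back) = recover x<n ; (y-in , y-back) = recover y<n in
        trans (sym x-back) (trans (cong label (place-injective x-in y-in eq)) y-back)

pv-last : ∀ k → pv (suc k) (suc k) ≡ 3
pv-last k rewrite Equivalence.to T-≡ (≡⇒≡ᵇ k k refl) = refl

pv-interior : ∀ {k t} → t < k → pv (suc k) (suc t) ≡ 6 + t
pv-interior {k} {t} t<k with t ≡ᵇ k in t≡ᵇk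
... | true = ⊥-elim (<⇒≢ t<k (≡ᵇ⇒≡ t k (subst T (sym t≡ᵇk) tt)))
... | false = refl

roleH : ℕ → ℕ → ℕ ⊎ Fin 4
roleH k 0 = inj₁ 0
roleH k 1 = inj₂ (# 0)
roleH k 2 = inj₂ (# 1)
roleH k 3 = inj₁ (suc k)
roleH k 4 = inj₂ (# 2)
roleH k 5 = inj₂ (# 3)
roleH k (suc (suc (suc (suc (suc (suc t)))))) = inj₁ (suc t)

roleH-pv : ∀ k j → roleH k (pv (suc k) j) ≡ inj₁ j
roleH-pv k zero = refl
roleH-pv k (suc j) with j ≡ᵇ k in j≡ᵇk
... | true = cong (inj₁ ∘ suc) (sym (≡ᵇ⇒≡ j k (subst T (sym j≡ᵇk) tt)))
... | false = refl

HSubgraph-zero⇒Contains : HSubgraph G 0 → Contains G (H 0)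
HSubgraph-zero⇒Contains {G} h = labelled-embedding h role label recover edges
  where
    open HSubgraph h

    role : ℕ → ℕ ⊎ Fin 4
    role 0 = inj₁ 0
    role 1 = inj₂ (# 0)
    role 2 = inj₂ (# 1)
    role 3 = inj₂ (# 2)
    role _ = inj₂ (# 3)

    label : ℕ ⊎ Fin 4 → ℕ
    label (inj₁ _) = 0
    label (inj₂ i) = suc (toℕ i)

    recover : ∀ {x} → x < 5 → InRange h (role x) × label (role x) ≡ x
    recover {0} _ = z≤n , refl
    recover {1} _ = tt , refl
    recover {2} _ = tt , refl
    recover {3} _ = tt , refl
    recover {4} _ = tt , refl
    recover {suc (suc (suc (suc (suc _))))} (s≤s (s≤s (s≤s (s≤s (s≤s ())))))

    edges : ∀ {x y} → (x , y) ∈ ((0 , 1) ∷ (0 , 2) ∷ (0 , 3) ∷ (0 , 4) ∷ []) →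
            Edge G (place h (role x)) (place h (role y))
    edges (here refl) = x₁-adjacent
    edges (there (here refl)) = x₂-adjacent
    edges (there (there (here refl))) = y₁-adjacent
    edges (there (there (there (here refl)))) = y₂-adjacent

HSubgraph-suc⇒Contains : HSubgraph G (suc k) → Contains G (H (suc k))
HSubgraph-suc⇒Contains {G} {k} h = labelled-embedding h (roleH k) label recover edges
  where
    open HSubgraph h

    label : ℕ ⊎ Fin 4 → ℕ
    label (inj₁ t) = pv (suc k) t
    label (inj₂ i) = lookup (1 ∷ 2 ∷ 4 ∷ 5 ∷ []) i

    recover : ∀ {x} → x < suc k + 5 → InRange h (roleH k x) × label (roleH k x) ≡ x
    recover {0} _ = z≤n , refl
    recover {1} _ = tt , refl
    recover {2} _ = tt , refl
    recover {3} _ = ≤-refl , pv-last k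
    recover {4} _ = tt , refl
    recover {5} _ = tt , refl
    recover {suc (suc (suc (suc (suc (suc t)))))} 6+t<k+6 = s≤s (<⇒≤ t<k) , pv-interior t<k
      where
        t<k : t < k
        t<k = +-cancelˡ-≤ 5 (suc t) k (subst (6 + t ≤_) (+-comm k 5) (≤-pred 6+t<k+6))

    edges : ∀ {x y} → (x , y) ∈ ((0 , 1) ∷ (0 , 2) ∷ (3 , 4) ∷ (3 , 5) ∷
              map (λ j → (pv (suc k) j , pv (suc k) (suc j))) (upTo (suc k))) →
            Edge G (place h (roleH k x)) (place h (roleH k y))
    edges (here refl) = x₁-adjacent
    edges (there (here refl)) = x₂-adjacent
    edges (there (there (here refl))) = y₁-adjacent
    edges (there (there (there (here refl)))) = y₂-adjacent
    edges (there (there (there (there e∈)))) with ∈-map⁻ _ e∈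
    ... | j , j∈ , refl = subst₂ (Edge G) (sym (cong (place h) (roleH-pv k j)))
                            (sym (cong (place h) (roleH-pv k (suc j)))) (adjacent spine (∈-upTo⁻ j∈))

HSubgraph⇒Contains : HSubgraph G k → Contains G (H k)
HSubgraph⇒Contains {k = zero} = HSubgraph-zero⇒Contains
HSubgraph⇒Contains {k = suc k} = HSubgraph-suc⇒Contains

ContainsSomeH : Graph → Set
ContainsSomeH G = ∃ λ k → Contains G (H k)

module _ {G : Graph} (P : Path G n) where

  branches⇒HSubgraph : ∀ {a z₁ z₂} → L + suc a < n →
    Edge G (vertex P (suc a)) z₁ → Edge G (vertex P (L + suc a)) z₂ →
    ¬ OnPath P z₁ → ¬ OnPath P z₂ → z₁ ≢ z₂ → HSubgraph G L
  branches⇒HSubgraph {L} {a} {z₁} {z₂} b<n e₁ e₂ z₁∉P z₂∉P z₁≢z₂ = record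
    { spine          = spine
    ; x₁-adjacent    = edge-sym G (adjacent P a<n)
    ; x₂-adjacent    = e₁
    ; y₁-adjacent    = adjacent P b<n
    ; y₂-adjacent    = e₂
    ; legs-off-spine = subpath-outside P (suc a) b≤n a≤n (inj₁ ≤-refl) ∷ z₁∉P ∘ subpath-⊆ P _ b≤n
                     ∷ subpath-outside P (suc a) b≤n b<n (inj₂ ≤-refl) ∷ z₂∉P ∘ subpath-⊆ P _ b≤n ∷ []
    ; legs-distinct  = (off-path-≢ P z₁∉P a≤n ∷ vertex-≢ P a≤n b<n (<⇒≢ (m<n⇒m<1+n a<b))
                         ∷ off-path-≢ P z₂∉P a≤n ∷ [])
                     ∷ (≢-sym (off-path-≢ P z₁∉P b<n) ∷ z₁≢z₂ ∷ [])
                     ∷ (off-path-≢ P z₂∉P b<n ∷ [])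
                     ∷ [] ∷ []
    }
    where
      b≤n : L + suc a ≤ n
      b≤n = <⇒≤ b<n

      spine : Path G L
      spine = subpath P (suc a) b≤n

      a<b : a < L + suc a
      a<b = m≤n+m (suc a) L

      a<n : a < n
      a<n = ≤-trans a<b b≤n

      a≤n : a ≤ n
      a≤n = <⇒≤ a<n

  ordered-branches⇒H : ∀ {i j z₁ z₂} → 0 < i → i ≤ j → j < n →
    Edge G (vertex P i) z₁ → Edge G (vertex P j) z₂ →
    ¬ OnPath P z₁ → ¬ OnPath P z₂ → z₁ ≢ z₂ → ContainsSomeH G
  ordered-branches⇒H {suc a} {j} _ i≤j with j ∸ suc a | m∸n+n≡m i≤j
  ... | L | refl = λ j<n e₁ e₂ z₁∉P z₂∉P z₁≢z₂ →
    L , HSubgraph⇒Contains (branches⇒HSubgraph j<n e₁ e₂ z₁∉P z₂∉P z₁≢z₂)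

  two-branches⇒H : ∀ {i j z₁ z₂} → 0 < i → i < n → 0 < j → j < n →
    Edge G (vertex P i) z₁ → Edge G (vertex P j) z₂ →
    ¬ OnPath P z₁ → ¬ OnPath P z₂ → z₁ ≢ z₂ → ContainsSomeH G
  two-branches⇒H {i} {j} 0<i i<n 0<j j<n e₁ e₂ z₁∉P z₂∉P z₁≢z₂ with ≤-total i j
  ... | inj₁ i≤j = ordered-branches⇒H 0<i i≤j j<n e₁ e₂ z₁∉P z₂∉P z₁≢z₂
  ... | inj₂ j≤i = ordered-branches⇒H 0<j j≤i i<n e₂ e₁ z₂∉P z₁∉P (≢-sym z₁≢z₂)

  spur-branch⇒HSubgraph : ∀ {i j z} (Q : Path G (L + suc j)) → suc i < n →
    vertex Q (L + suc j) ≡ vertex P (suc i) → (∀ {t} → t < L + suc j → ¬ OnPath P (vertex Q t)) →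
    Edge G (vertex Q (suc j)) z → ¬ OnPath Q z → ¬ OnPath P z → HSubgraph G L
  spur-branch⇒HSubgraph {L} {i} {j} {z} Q i<n Q-end Q∉P e z∉Q z∉P = record
    { spine          = spine
    ; x₁-adjacent    = edge-sym G (adjacent Q j<m)
    ; x₂-adjacent    = e
    ; y₁-adjacent    = subst (λ v → Edge G v (vertex P i)) (sym Q-end) (edge-sym G (adjacent P (<⇒≤ i<n)))
    ; y₂-adjacent    = subst (λ v → Edge G v (vertex P (suc (suc i)))) (sym Q-end) (adjacent P i<n)
    ; legs-off-spine = subpath-outside Q (suc j) ≤-refl j≤m (inj₁ ≤-refl) ∷ z∉Q ∘ subpath-⊆ Q _ ≤-refl
                     ∷ P-off-spine i≤n (<⇒≢ (n<1+n i)) ∷ P-off-spine i<n (>⇒≢ (n<1+n (suc i))) ∷ []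
    ; legs-distinct  = (off-path-≢ Q z∉Q j≤m ∷ Qⱼ≢P i≤n ∷ Qⱼ≢P i<n ∷ [])
                     ∷ (≢-sym (off-path-≢ P z∉P i≤n) ∷ ≢-sym (off-path-≢ P z∉P i<n) ∷ [])
                     ∷ (vertex-≢ P i≤n i<n (<⇒≢ (m<n⇒m<1+n (n<1+n i))) ∷ [])
                     ∷ [] ∷ []
    }
    where
      spine : Path G L
      spine = subpath Q (suc j) ≤-refl

      i≤n : i ≤ n
      i≤n = ≤-trans (n≤1+n i) (<⇒≤ i<n)

      j<m : j < L + suc j
      j<m = m≤n+m (suc j) L

      j≤m : j ≤ L + suc j
      j≤m = <⇒≤ j<m

      Qⱼ≢P : ∀ {p} → p ≤ n → vertex Q j ≢ vertex P p
      Qⱼ≢P p≤n eq = Q∉P j<m (_ , p≤n , sym eq)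

      P-off-spine : ∀ {p} → p ≤ n → p ≢ suc i → ¬ OnPath spine (vertex P p)
      P-off-spine p≤n p≢1+i (t , t≤L , eq) with m≤n⇒m<n∨m≡n t≤L
      ... | inj₁ t<L = Q∉P (+-monoˡ-< (suc j) t<L) (_ , p≤n , sym eq)
      ... | inj₂ refl = p≢1+i (injective P p≤n (<⇒≤ i<n) (trans (sym eq) Q-end))

  spur-branch⇒H : ∀ {i j z} (Q : Path G m) → 0 < i → i < n → vertex Q m ≡ vertex P i →
    (∀ {t} → t < m → ¬ OnPath P (vertex Q t)) →
    0 < j → j < m → Edge G (vertex Q j) z → ¬ OnPath Q z → ¬ OnPath P z → ContainsSomeH G
  spur-branch⇒H {m} {suc i} {suc j} Q _ i<n Q-end Q∉P _ j<m with m ∸ suc j | m∸n+n≡m (<⇒≤ j<m)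
  ... | L | refl = λ e z∉Q z∉P → L , HSubgraph⇒Contains (spur-branch⇒HSubgraph Q i<n Q-end Q∉P e z∉Q z∉P)

module FourLeaves {G : Graph} (ℓ : Fin 4 → V G) (ℓ-injective : Injective _≡_ _≡_ ℓ)
                  (ℓ-leaf : ∀ i → Leaf G (ℓ i)) (ℓ-reach : ∀ i → Reach G (ℓ 0F) (ℓ i)) where

  ℓ-distinct : ∀ {i j} → i ≢ j → ℓ i ≢ ℓ j
  ℓ-distinct i≢j = i≢j ∘ ℓ-injective

  module _ {n} (ℓ₀⇝ℓ₁ : PathInto G (ℓ 0F) (_≡ ℓ (# 1)) (suc n)) where

    P : Path G (suc n)
    P = path ℓ₀⇝ℓ₁

    P-leaf₀ : Leaf G (vertex P 0)
    P-leaf₀ = subst (Leaf G) (sym (starts ℓ₀⇝ℓ₁)) (ℓ-leaf 0F)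

    P-leafₙ : Leaf G (vertex P (suc n))
    P-leafₙ = subst (Leaf G) (sym (ends ℓ₀⇝ℓ₁)) (ℓ-leaf (# 1))

    leaf∉P : ∀ {v} → Leaf G v → v ≢ ℓ 0F → v ≢ ℓ (# 1) → ¬ OnPath P v
    leaf∉P leaf v≢ℓ₀ v≢ℓ₁ v∈P with leaf-on-path-is-endpoint P v∈P leaf
    ... | inj₁ v≡P₀ = v≢ℓ₀ (trans v≡P₀ (starts ℓ₀⇝ℓ₁))
    ... | inj₂ v≡Pₙ = v≢ℓ₁ (trans v≡Pₙ (ends ℓ₀⇝ℓ₁))

    ℓ₂∉P : ¬ OnPath P (ℓ (# 2))
    ℓ₂∉P = leaf∉P (ℓ-leaf (# 2)) (ℓ-distinct λ ()) (ℓ-distinct λ ())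

    module _ {m} (ℓ₂⇝P : PathInto G (ℓ (# 2)) (OnPath P) (suc m)) where

      Q : Path G (suc m)
      Q = path ℓ₂⇝P

      i : ℕ
      i = proj₁ (ends ℓ₂⇝P)

      i≤n : i ≤ suc n
      i≤n = proj₁ (proj₂ (ends ℓ₂⇝P))

      Pᵢ≡Qₘ : vertex P i ≡ vertex Q (suc m)
      Pᵢ≡Qₘ = proj₂ (proj₂ (ends ℓ₂⇝P))

      q⁻ : V G
      q⁻ = vertex Q m

      q⁻∉P : ¬ OnPath P q⁻
      q⁻∉P = avoids ℓ₂⇝P ≤-refl

      Pᵢ~q⁻ : Edge G (vertex P i) q⁻
      Pᵢ~q⁻ = subst (λ v → Edge G v q⁻) (sym Pᵢ≡Qₘ) (edge-sym G (adjacent Q ≤-refl))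

      i-internal : 0 < i × i < suc n
      i-internal = off-path-neighbour⇒internal P z<s P-leaf₀ P-leafₙ i≤n Pᵢ~q⁻ q⁻∉P

      branch-off-P⇒H : ∀ {y z} → OnPath P y → Edge G y z → ¬ OnPath P z → ¬ OnPath Q z → ContainsSomeH G
      branch-off-P⇒H (j , j≤n , refl) e z∉P z∉Q =
        let (0<i , i<n) = i-internal
            (0<j , j<n) = off-path-neighbour⇒internal P z<s P-leaf₀ P-leafₙ j≤n e z∉P
        in two-branches⇒H P 0<i i<n 0<j j<n Pᵢ~q⁻ e q⁻∉P z∉P (λ q⁻≡z → z∉Q (m , n≤1+n m , q⁻≡z))

      branch-off-Q⇒H : ∀ {y z} → OnPath Q y → Edge G y z → ¬ OnPath P z → ¬ OnPath Q z → ContainsSomeH G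
      branch-off-Q⇒H (zero , _ , refl) e _ z∉Q =
        ⊥-elim (z∉Q (leaf-neighbour-on-path Q z<s z≤n (subst (Leaf G) (sym (starts ℓ₂⇝P)) (ℓ-leaf (# 2))) e))
      branch-off-Q⇒H (suc j , j<1+m , refl) e z∉P z∉Q with m≤n⇒m<n∨m≡n j<1+m
      ... | inj₂ refl = branch-off-P⇒H (i , i≤n , Pᵢ≡Qₘ) e z∉P z∉Q
      ... | inj₁ 1+j<1+m =
        spur-branch⇒H P Q (proj₁ i-internal) (proj₂ i-internal) (sym Pᵢ≡Qₘ) (avoids ℓ₂⇝P)
          z<s 1+j<1+m e z∉Q z∉P

      branch-off-P∪Q⇒H : ∀ {y z} → OnPath P y ⊎ OnPath Q y → Edge G y z → ¬ (OnPath P z ⊎ OnPath Q z) →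
        ContainsSomeH G
      branch-off-P∪Q⇒H (inj₁ y∈P) e z∉P∪Q = branch-off-P⇒H y∈P e (z∉P∪Q ∘ inj₁) (z∉P∪Q ∘ inj₂)
      branch-off-P∪Q⇒H (inj₂ y∈Q) e z∉P∪Q = branch-off-Q⇒H y∈Q e (z∉P∪Q ∘ inj₁) (z∉P∪Q ∘ inj₂)

      ℓ₃∉P∪Q : ¬ (OnPath P (ℓ (# 3)) ⊎ OnPath Q (ℓ (# 3)))
      ℓ₃∉P∪Q (inj₁ ℓ₃∈P) = leaf∉P (ℓ-leaf (# 3)) (ℓ-distinct λ ()) (ℓ-distinct λ ()) ℓ₃∈P
      ℓ₃∉P∪Q (inj₂ ℓ₃∈Q) with leaf-on-path-is-endpoint Q ℓ₃∈Q (ℓ-leaf (# 3))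
      ... | inj₁ ℓ₃≡Q₀ = ℓ-distinct (λ ()) (trans ℓ₃≡Q₀ (starts ℓ₂⇝P))
      ... | inj₂ ℓ₃≡Qₘ = ℓ₃∉P∪Q (inj₁ (i , i≤n , trans Pᵢ≡Qₘ (sym ℓ₃≡Qₘ)))

  four-leaves⇒H : ContainsSomeH G
  four-leaves⇒H with reach⇒pathInto (λ v → v Finₚ.≟ ℓ (# 1)) (ℓ-reach (# 1)) refl
  ... | zero , ℓ₀⇝ℓ₁ = ⊥-elim (ℓ-distinct (λ ()) (PathInto-zero ℓ₀⇝ℓ₁))
  ... | suc n , ℓ₀⇝ℓ₁ with reach⇒pathInto (onPath? (P ℓ₀⇝ℓ₁))
                             (Reach-sym (ℓ-reach (# 2))) (0 , z≤n , starts ℓ₀⇝ℓ₁)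
  ...   | zero , ℓ₂⇝P = ⊥-elim (ℓ₂∉P ℓ₀⇝ℓ₁ (PathInto-zero ℓ₂⇝P))
  ...   | suc m , ℓ₂⇝P with reach⇒pathInto (λ v → onPath? (P ℓ₀⇝ℓ₁) v ⊎-dec onPath? (Q ℓ₀⇝ℓ₁ ℓ₂⇝P) v)
                               (Reach-sym (ℓ-reach (# 3))) (inj₁ (0 , z≤n , starts ℓ₀⇝ℓ₁))
  ...     | zero , ℓ₃⇝P∪Q = ⊥-elim (ℓ₃∉P∪Q ℓ₀⇝ℓ₁ ℓ₂⇝P (PathInto-zero ℓ₃⇝P∪Q))
  ...     | suc k , ℓ₃⇝P∪Q = branch-off-P∪Q⇒H ℓ₀⇝ℓ₁ ℓ₂⇝P (ends ℓ₃⇝P∪Q)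
                               (edge-sym G (adjacent (path ℓ₃⇝P∪Q) ≤-refl)) (avoids ℓ₃⇝P∪Q ≤-refl)

noH⇒ComponentsAtMost3Leaves : (∀ k → ¬ Contains G (H k)) → ComponentsAtMost3Leaves G
noH⇒ComponentsAtMost3Leaves noH ℓ ℓ-injective ℓ-leaf ℓ-reach =
  let (k , G⊇Hk) = FourLeaves.four-leaves⇒H ℓ ℓ-injective ℓ-leaf ℓ-reach in noH k G⊇Hk

k≤size-H : ∀ k → k ≤ size (H k)
k≤size-H zero = z≤n
k≤size-H (suc k) = m≤m+n (suc k) 5

lemma15 : (M : List Graph) → (∀ F → F ∈ M → InS F → ⊥) →
    Σ ℕ λ r → 3 ≤ r × (∀ G → InSk r G → ∀ F → F ∈ M → SiSub F G → ⊥)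
lemma15 M M∩𝒮≡∅ = 3 + total , m≤m+n 3 total , M-free
  where
    total : ℕ
    total = sum (map size M)

    M-free : ∀ G → InSk (3 + total) G → ∀ F → F ∈ M → SiSub F G → ⊥
    M-free G (no-C , no-H) F F∈M F⊑G = M∩𝒮≡∅ F F∈M (F-forest , noH⇒ComponentsAtMost3Leaves F-no-H)
      where
        G⊇F : Contains G F
        G⊇F = SiSub⇒Contains {F} {G} F⊑G

        small : ∀ X → Contains F X → size X ≤ 3 + total
        small X F⊇X = ≤-trans (Contains⇒size≤ {F} {X} F⊇X) (≤-trans (∈⇒≤sum size F∈M) (m≤n+m total 3))

        F-forest : Forest F
        F-forest j 3≤j F⊇Cⱼ = no-C j 3≤j (small (C j) F⊇Cⱼ) (Contains-trans {G} {F} {C j} G⊇F F⊇Cⱼ)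

        F-no-H : ∀ j → ¬ Contains F (H j)
        F-no-H j F⊇Hⱼ =
          no-H j (≤-trans (k≤size-H j) (small (H j) F⊇Hⱼ)) (Contains-trans {G} {F} {H j} G⊇F F⊇Hⱼ)
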